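{- Let $n\geq 4$ and $k\geq 3$ be integers, and let $\alpha\colon\mathbb{Z}_{2n+1}\to\{1,\dots,k\}$ be a $k$-coloring of $\vec{C}_{2n+1}\langle n\rangle$. Suppose some color class $C_j^\alpha$ of $\alpha$ is not a forbidden triangle. Then there exist $a\in\mathbb{Z}_{2n+1}$ and a $k$-coloring $\beta\colon\mathbb{Z}_{2n+1}\to\{1,\dots,k\}$ with $C_j^\beta=\{a,a+1,\dots,a+n-1\}$ such that, in $\mathcal{D}_k(\vec{C}_{2n+1}\langle n\rangle)$, $d(\alpha,\beta)\leq n-|C_j^\alpha|$ if $|C_j^\alpha|\in\{0,1\}$, and $d(\alpha,\beta)\leq n+2-|C_j^\alpha|$ otherwise.
   Context: For $n\ge2$, $\vec{C}_{2n+1}\langle n\rangle$ is the tournament with vertex set $\mathbb{Z}_{2n+1}$ and arcs $(a,a+j)$ for all $a\in\mathbb{Z}_{2n+1}$, $j\in\{1,\dots,n-1\}$, together with arcs $(a,a-n)$ for all $a\in\mathbb{Z}_{2n+1}$. A forbidden triangle is a subset of $\mathbb{Z}_{2n+1}$ of the form $\{i,i+n,i+n+1\}$ with $i\in\mathbb{Z}_{2n+1}$. A $k$-coloring of a digraph $D$ is a function $\alpha\colon V(D)\to\{1,\dots,k\}$ such that every color class $C_i^\alpha=\{x:\alpha(x)=i\}$ (possibly empty) induces an acyclic subdigraph. The $k$-dicoloring graph $\mathcal{D}_k(D)$ has the $k$-colorings of $D$ as vertices, two being adjacent iff they differ on exactly one vertex; $d$ denotes distance in it. -}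

module Defs where

open import Data.Nat using (ℕ; zero; suc; _+_; _∸_; _<_; _≤_; NonZero)
open import Data.Nat.DivMod using (_%_; _mod_)
open import Data.Fin using (Fin; toℕ)
open import Data.Fin.Properties using (_≟_)
open import Data.List using (List; length; filter; allFin)
open import Data.Product using (Σ; ∃; ∃-syntax; _×_; _,_)
open import Data.Sum using (_⊎_)
open import Relation.Binary.PropositionalEquality using (_≡_; _≢_)
open import Relation.Nullary using (¬_)

N : ℕ → ℕ
N n = suc (n + n)

V : ℕ → Set
V n = Fin (N n)

add : (n : ℕ) → V n → ℕ → V n
add n a m = (toℕ a + m) mod (N n)

diff : (n : ℕ) → V n → V n → ℕ
diff n a b = (toℕ b + N n ∸ toℕ a) % N n

-- Arcs of C_{2n+1}⟨n⟩: (a, a+j) for j ∈ {1,…,n-1}, and (a, a-n) = (a, a+n+1).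
Arc : (n : ℕ) → V n → V n → Set
Arc n a b = (1 ≤ diff n a b × diff n a b ≤ n ∸ 1) ⊎ (diff n a b ≡ suc n)

data Walk⁺ (n : ℕ) (S : V n → Set) : V n → V n → Set where
  arc  : ∀ {x y} → S x → S y → Arc n x y → Walk⁺ n S x y
  _∷_  : ∀ {x y z} → S x → Σ (Arc n x y) (λ _ → Walk⁺ n S y z) → Walk⁺ n S x z

Acyclic : (n : ℕ) → (V n → Set) → Set
Acyclic n S = ∀ x → ¬ Walk⁺ n S x x

-- Color class C_i^α (colors {1,…,k} represented by Fin k).
Class : (n k : ℕ) → (V n → Fin k) → Fin k → V n → Set
Class n k α i x = α x ≡ i

IsColoring : (n k : ℕ) → (V n → Fin k) → Set
IsColoring n k α = ∀ i → Acyclic n (Class n k α i)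

Coloring : ℕ → ℕ → Set
Coloring n k = Σ (V n → Fin k) (IsColoring n k)

col : (n k : ℕ) → Coloring n k → V n → Fin k
col n k (α , _) = α

Adj : (n k : ℕ) → Coloring n k → Coloring n k → Set
Adj n k α β = ∃[ v ] (col n k α v ≢ col n k β v × (∀ w → w ≢ v → col n k α w ≡ col n k β w))

data PathLen (n k : ℕ) : Coloring n k → Coloring n k → ℕ → Set where
  here : ∀ {α} → PathLen n k α α zero
  step : ∀ {α γ β m} → Adj n k α γ → PathLen n k γ β m → PathLen n k α β (suc m)

DistLe : (n k : ℕ) → Coloring n k → Coloring n k → ℕ → Set
DistLe n k α β m = ∃[ l ] (PathLen n k α β l × l ≤ m)

classSize : (n k : ℕ) → (V n → Fin k) → Fin k → ℕ
classSize n k α j = length (filter (λ x → α x ≟ j) (allFin (N n)))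

IsForbiddenTriangle : (n k : ℕ) → (V n → Fin k) → Fin k → Set
IsForbiddenTriangle n k α j =
  ∃[ i ] (∀ x → (α x ≡ j → (x ≡ i ⊎ x ≡ add n i n ⊎ x ≡ add n i (suc n)))
              × ((x ≡ i ⊎ x ≡ add n i n ⊎ x ≡ add n i (suc n)) → α x ≡ j))

IsInterval : (n k : ℕ) → (V n → Fin k) → Fin k → V n → Set
IsInterval n k β j a =
  ∀ x → (β x ≡ j → ∃[ t ] (t < n × x ≡ add n a t))
      × (∃[ t ] (t < n × x ≡ add n a t) → β x ≡ j)

{-# OPTIONS --safe #-}
module Submission where

-- Measure every vertex by its offset diff n a x from a base point a. Inside a set of offsets in
-- [0, n + 1] every arc increases the offset, except n → 0 and n + 1 → 1; so the interval
-- a + [0, n) and the bent interval {a} ∪ a + [2, n) ∪ {a + n + 1} are acyclic.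
-- Let s be a source of the class C of j. Every other member of C is an out-neighbour of s, at
-- offset in [1, n) or n + 1. If n + 1 is not used, C lies in the interval at s; if n + 1 is used
-- but 1 is not, C lies in the bent interval at s; if both are used, a member at offset
-- r ∈ [2, n) would close the cycle s + 1 → r → s + n + 1 → s + 1, so C is the forbidden
-- triangle {s + n + 1, s, s + 1}.
-- Colouring the missing vertices of the interval (or bent interval) with j one by one keeps
-- the class of j acyclic and costs n − |C| steps. From the bent interval two more steps
-- reach the interval: give s + n + 1 a third colour, absent from all its in-neighbours, and
-- then colour s + 1 with j.

open import Defs
open import Data.Nat using (ℕ; zero; suc; _+_; _∸_; _%_; _≤_; _<_; z≤n; s≤s; _≤?_)
open import Data.Nat.Properties
open import Data.Nat.DivMod using (%-distribˡ-+; m%n%n≡m%n; %-congˡ; n%n≡0; [m+n]%n≡m%n; m<n⇒m%n≡m; m%n<n)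
open import Data.Fin as F using (Fin; toℕ)
open import Data.Fin.Properties using (toℕ-injective; toℕ<n; toℕ-fromℕ<; pigeonhole; any?; all?)
  renaming (_≟_ to _≟ᶠ_)
open import Data.Product using (Σ; ∃-syntax; _×_; _,_; proj₁; proj₂)
open import Data.Sum using (_⊎_; inj₁; inj₂)
open import Data.Empty using (⊥; ⊥-elim)
open import Data.List using (List; []; _∷_; length; filter; map; upTo; allFin)
open import Data.List.Properties using (filter-all; filter-accept; filter-reject; length-map; length-upTo)
open import Data.List.Membership.Propositional using (_∈_)
open import Data.List.Membership.Propositional.Properties
  using (∈-filter⁺; ∈-filter⁻; ∈-allFin; ∈-map⁺; ∈-map⁻; ∈-upTo⁺; ∈-upTo⁻)
open import Data.List.Relation.Unary.Any using (here; there)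
import Data.List.Relation.Unary.All as All
open import Data.List.Relation.Unary.AllPairs using (_∷_)
open import Data.List.Relation.Unary.Unique.Propositional using (Unique)
import Data.List.Relation.Unary.Unique.Propositional.Properties as Unique
open import Relation.Binary.PropositionalEquality
open import Function using (_∘_)
open import Relation.Nullary using (¬_; Dec; yes; no; contradiction)
open import Relation.Nullary.Decidable using (¬?; _×-dec_; _⊎-dec_; _→-dec_)
open import Relation.Unary using (Decidable)
open import Relation.Binary.Definitions using (DecidableEquality; tri<; tri≈; tri>)

module ModularSubtraction (q : ℕ) where
  private
    P : ℕ
    P = suc q

  infixl 6 _⊖_
  _⊖_ : ℕ → ℕ → ℕ
  x ⊖ a = (x + P ∸ a) % P

  [m%P+n]%P≡[m+n]%P : ∀ m n → (m % P + n) % P ≡ (m + n) % P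
  [m%P+n]%P≡[m+n]%P m n = begin
    (m % P + n) % P          ≡⟨ %-distribˡ-+ (m % P) n P ⟩
    (m % P % P + n % P) % P  ≡⟨ cong (λ v → (v + n % P) % P) (m%n%n≡m%n m P) ⟩
    (m % P + n % P) % P      ≡⟨ %-distribˡ-+ m n P ⟨
    (m + n) % P              ∎
    where open ≡-Reasoning

  [m+n%P]%P≡[m+n]%P : ∀ m n → (m + n % P) % P ≡ (m + n) % P
  [m+n%P]%P≡[m+n]%P m n = begin
    (m + n % P) % P  ≡⟨ %-congˡ (+-comm m (n % P)) ⟩
    (n % P + m) % P  ≡⟨ [m%P+n]%P≡[m+n]%P n m ⟩
    (n + m) % P      ≡⟨ %-congˡ (+-comm n m) ⟩
    (m + n) % P      ∎
    where open ≡-Reasoning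

  +-cancelʳ-% : ∀ {a} x y → a ≤ P → (x + a) % P ≡ (y + a) % P → x % P ≡ y % P
  +-cancelʳ-% {a} x y a≤P eq = begin
    x % P                        ≡⟨ [m+n]%n≡m%n x P ⟨
    (x + P) % P                  ≡⟨ %-congˡ (cong (x +_) (m+[n∸m]≡n a≤P)) ⟨
    (x + (a + (P ∸ a))) % P      ≡⟨ %-congˡ (+-assoc x a (P ∸ a)) ⟨
    (x + a + (P ∸ a)) % P        ≡⟨ [m%P+n]%P≡[m+n]%P (x + a) (P ∸ a) ⟨
    ((x + a) % P + (P ∸ a)) % P  ≡⟨ cong (λ v → (v + (P ∸ a)) % P) eq ⟩
    ((y + a) % P + (P ∸ a)) % P  ≡⟨ [m%P+n]%P≡[m+n]%P (y + a) (P ∸ a) ⟩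
    (y + a + (P ∸ a)) % P        ≡⟨ %-congˡ (+-assoc y a (P ∸ a)) ⟩
    (y + (a + (P ∸ a))) % P      ≡⟨ %-congˡ (cong (y +_) (m+[n∸m]≡n a≤P)) ⟩
    (y + P) % P                  ≡⟨ [m+n]%n≡m%n y P ⟩
    y % P                        ∎
    where open ≡-Reasoning

  ⊖-< : ∀ x a → x ⊖ a < P
  ⊖-< x a = m%n<n (x + P ∸ a) P

  [a+x⊖a]%P≡x : ∀ {a x} → a ≤ P → x < P → (a + (x ⊖ a)) % P ≡ x
  [a+x⊖a]%P≡x {a} {x} a≤P x<P = begin
    (a + (x ⊖ a)) % P      ≡⟨ [m+n%P]%P≡[m+n]%P a (x + P ∸ a) ⟩
    (a + (x + P ∸ a)) % P  ≡⟨ %-congˡ (m+[n∸m]≡n (≤-trans a≤P (m≤n+m P x))) ⟩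
    (x + P) % P            ≡⟨ [m+n]%n≡m%n x P ⟩
    x % P                  ≡⟨ m<n⇒m%n≡m x<P ⟩
    x                      ∎
    where open ≡-Reasoning

  ⊖-unique : ∀ {a d x} → a ≤ P → d < P → (a + d) % P ≡ x → x ⊖ a ≡ d
  ⊖-unique {a} {d} {x} a≤P d<P eq =
    trans (+-cancelʳ-% (x + P ∸ a) d a≤P shifted) (m<n⇒m%n≡m d<P)
    where
    open ≡-Reasoning
    shifted : (x + P ∸ a + a) % P ≡ (d + a) % P
    shifted = begin
      (x + P ∸ a + a) % P  ≡⟨ %-congˡ (m∸n+n≡m (≤-trans a≤P (m≤n+m P x))) ⟩
      (x + P) % P          ≡⟨ [m+n]%n≡m%n x P ⟩
      x % P                ≡⟨ %-congˡ eq ⟨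
      (a + d) % P % P      ≡⟨ m%n%n≡m%n (a + d) P ⟩
      (a + d) % P          ≡⟨ %-congˡ (+-comm a d) ⟩
      (d + a) % P          ∎

  a≤x⇒x⊖a≡x∸a : ∀ {a x} → a ≤ x → x < P → x ⊖ a ≡ x ∸ a
  a≤x⇒x⊖a≡x∸a {a} {x} a≤x x<P =
    ⊖-unique (≤-trans a≤x (<⇒≤ x<P)) (≤-<-trans (m∸n≤m x a) x<P)
      (trans (%-congˡ (m+[n∸m]≡n a≤x)) (m<n⇒m%n≡m x<P))

  x<a⇒x⊖a≡x+P∸a : ∀ {a x} → x < a → a ≤ P → x ⊖ a ≡ x + P ∸ a
  x<a⇒x⊖a≡x+P∸a {a} {x} x<a a≤P = ⊖-unique a≤P x+P∸a<P
    (trans (%-congˡ (m+[n∸m]≡n (≤-trans a≤P (m≤n+m P x))))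
      (trans ([m+n]%n≡m%n x P) (m<n⇒m%n≡m (<-≤-trans x<a a≤P))))
    where
    x+P∸a<P : x + P ∸ a < P
    x+P∸a<P = subst (x + P ∸ a <_) (m+n∸m≡n a P)
      (∸-monoˡ-< (+-monoˡ-< P x<a) (≤-trans a≤P (m≤n+m P x)))

  x⊖x≡0 : ∀ {x} → x < P → x ⊖ x ≡ 0
  x⊖x≡0 {x} x<P = trans (a≤x⇒x⊖a≡x∸a ≤-refl x<P) (n∸n≡0 x)

module Offsets (n : ℕ) where
  open ModularSubtraction (n + n) public

  -- diff n a x is definitionally toℕ x ⊖ toℕ a.

  diff-< : ∀ a x → diff n a x < N n
  diff-< a x = ⊖-< (toℕ x) (toℕ a)

  [a+diff]%N≡x : ∀ a x → (toℕ a + diff n a x) % N n ≡ toℕ x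
  [a+diff]%N≡x a x = [a+x⊖a]%P≡x (<⇒≤ (toℕ<n a)) (toℕ<n x)

  toℕ-add : ∀ a t → toℕ (add n a t) ≡ (toℕ a + t) % N n
  toℕ-add a t = toℕ-fromℕ< (m%n<n (toℕ a + t) (N n))

  add-diff : ∀ a x → add n a (diff n a x) ≡ x
  add-diff a x = toℕ-injective
    (trans (toℕ-add a (diff n a x)) ([a+diff]%N≡x a x))

  diff-add : ∀ a {t} → t < N n → diff n a (add n a t) ≡ t
  diff-add a {t} t<N = ⊖-unique (<⇒≤ (toℕ<n a)) t<N (sym (toℕ-add a t))

  diff-injective : ∀ a {x y} → diff n a x ≡ diff n a y → x ≡ y
  diff-injective a {x} {y} eq = begin
    x                     ≡⟨ add-diff a x ⟨
    add n a (diff n a x)  ≡⟨ cong (add n a) eq ⟩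
    add n a (diff n a y)  ≡⟨ add-diff a y ⟩
    y                     ∎
    where open ≡-Reasoning

  diff-self : ∀ a → diff n a a ≡ 0
  diff-self a = x⊖x≡0 (toℕ<n a)

  diff-relative : ∀ s x y → diff n x y ≡ diff n s y ⊖ diff n s x
  diff-relative s x y = ⊖-unique (<⇒≤ (toℕ<n x)) (⊖-< oy ox) (begin
    (toℕ x + (oy ⊖ ox)) % N n              ≡⟨ cong (λ v → (v + (oy ⊖ ox)) % N n) ([a+diff]%N≡x s x) ⟨
    ((toℕ s + ox) % N n + (oy ⊖ ox)) % N n  ≡⟨ [m%P+n]%P≡[m+n]%P (toℕ s + ox) (oy ⊖ ox) ⟩
    (toℕ s + ox + (oy ⊖ ox)) % N n          ≡⟨ %-congˡ (+-assoc (toℕ s) ox (oy ⊖ ox)) ⟩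
    (toℕ s + (ox + (oy ⊖ ox))) % N n        ≡⟨ [m+n%P]%P≡[m+n]%P (toℕ s) (ox + (oy ⊖ ox)) ⟨
    (toℕ s + (ox + (oy ⊖ ox)) % N n) % N n  ≡⟨ cong (λ v → (toℕ s + v) % N n) (ox+[oy⊖ox]%N≡oy) ⟩
    (toℕ s + oy) % N n                     ≡⟨ [a+diff]%N≡x s y ⟩
    toℕ y                                  ∎)
    where
    open ≡-Reasoning
    ox oy : ℕ
    ox = diff n s x
    oy = diff n s y
    ox+[oy⊖ox]%N≡oy : (ox + (oy ⊖ ox)) % N n ≡ oy
    ox+[oy⊖ox]%N≡oy = [a+x⊖a]%P≡x (<⇒≤ (diff-< s x)) (diff-< s y)

  diff-add-shift : ∀ s z m → diff n s (add n z m) ≡ (diff n s z + m) % N n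
  diff-add-shift s z m = ⊖-unique (<⇒≤ (toℕ<n s)) (m%n<n (oz + m) (N n)) (begin
    (toℕ s + (oz + m) % N n) % N n  ≡⟨ [m+n%P]%P≡[m+n]%P (toℕ s) (oz + m) ⟩
    (toℕ s + (oz + m)) % N n        ≡⟨ %-congˡ (+-assoc (toℕ s) oz m) ⟨
    (toℕ s + oz + m) % N n          ≡⟨ [m%P+n]%P≡[m+n]%P (toℕ s + oz) m ⟨
    ((toℕ s + oz) % N n + m) % N n  ≡⟨ cong (λ v → (v + m) % N n) ([a+diff]%N≡x s z) ⟩
    (toℕ z + m) % N n               ≡⟨ toℕ-add z m ⟨
    toℕ (add n z m)                 ∎)
    where
    open ≡-Reasoning
    oz : ℕ
    oz = diff n s z

m+m∸1+m≡m∸1 : ∀ m → m + m ∸ suc m ≡ m ∸ 1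
m+m∸1+m≡m∸1 zero    = refl
m+m∸1+m≡m∸1 (suc m) = m+n∸n≡m m (suc m)

module Tournament (n : ℕ) (1≤n : 1 ≤ n) where
  open Offsets n public

  -- Arc n x y is definitionally ArcDiff (diff n x y).
  ArcDiff : ℕ → Set
  ArcDiff d = (1 ≤ d × d ≤ n ∸ 1) ⊎ d ≡ suc n

  ¬ArcDiff-0 : ¬ ArcDiff 0
  ¬ArcDiff-0 (inj₁ (() , _))
  ¬ArcDiff-0 (inj₂ ())

  arc-relative : ∀ s {x y} → Arc n x y → ArcDiff (diff n s y ⊖ diff n s x)
  arc-relative s {x} {y} = subst ArcDiff (diff-relative s x y)

  arc-relative⁻ : ∀ s {x y} → ArcDiff (diff n s y ⊖ diff n s x) → Arc n x y
  arc-relative⁻ s {x} {y} = subst ArcDiff (sym (diff-relative s x y))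

  arc-irreflexive : ∀ x → ¬ Arc n x x
  arc-irreflexive x a = ¬ArcDiff-0 (subst ArcDiff (diff-self x) a)

  n<N : n < N n
  n<N = s≤s (m≤n+m n n)

  N∸n≡1+n : N n ∸ n ≡ suc n
  N∸n≡1+n = trans (+-∸-assoc 1 (m≤n+m n n)) (cong suc (m+n∸n≡m n n))

  arcDiff⊎arcDiff-complement : ∀ {d} → 0 < d → d < N n → ArcDiff d ⊎ ArcDiff (N n ∸ d)
  arcDiff⊎arcDiff-complement {d} 0<d d<N with <-cmp d n
  ... | tri< d<n _ _ = inj₁ (inj₁ (0<d , ∸-monoˡ-≤ 1 d<n))
  ... | tri≈ _ refl _ = inj₂ (inj₂ N∸n≡1+n)
  ... | tri> _ _ n<d with <-cmp d (suc n)
  ... | tri< d<1+n _ _ = contradiction n<d (≤⇒≯ (≤-pred d<1+n))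
  ... | tri≈ _ d≡1+n _ = inj₁ (inj₂ d≡1+n)
  ... | tri> _ _ 1+n<d = inj₂ (inj₁ (m<n⇒0<n∸m d<N ,
          ≤-trans (∸-monoʳ-≤ (N n) 1+n<d) (≤-reflexive (m+m∸1+m≡m∸1 n))))

  diff-positive : ∀ {x y} → x ≢ y → 0 < diff n x y
  diff-positive {x} {y} x≢y =
    n≢0⇒n>0 λ d≡0 → x≢y (diff-injective x (trans (diff-self x) (sym d≡0)))

  diff-flip : ∀ {x y} → x ≢ y → diff n y x ≡ N n ∸ diff n x y
  diff-flip {x} {y} x≢y = begin
    diff n y x               ≡⟨ diff-relative x y x ⟩
    diff n x x ⊖ diff n x y  ≡⟨ cong (_⊖ diff n x y) (diff-self x) ⟩
    0 ⊖ diff n x y           ≡⟨ x<a⇒x⊖a≡x+P∸a (diff-positive x≢y) (<⇒≤ (diff-< x y)) ⟩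
    N n ∸ diff n x y         ∎
    where open ≡-Reasoning

  tournament : ∀ {x y} → x ≢ y → Arc n x y ⊎ Arc n y x
  tournament {x} {y} x≢y
    with arcDiff⊎arcDiff-complement (diff-positive x≢y) (diff-< x y)
  ... | inj₁ xy = inj₁ xy
  ... | inj₂ yx = inj₂ (subst ArcDiff (sym (diff-flip x≢y)) yx)

  1+n<N : suc n < N n
  1+n<N = s≤s (subst (_≤ n + n) (+-comm n 1) (+-monoʳ-≤ n 1≤n))

  ≤n∸1⇒<n : ∀ {d} → d ≤ n ∸ 1 → d < n
  ≤n∸1⇒<n le = subst (_ <_) (m+[n∸m]≡n 1≤n) (s≤s le)

  arcDiff-range : ∀ {d} → ArcDiff d → d < n ⊎ d ≡ suc n
  arcDiff-range (inj₁ (_ , d≤n∸1)) = inj₁ (≤n∸1⇒<n d≤n∸1)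
  arcDiff-range (inj₂ d≡1+n)       = inj₂ d≡1+n

  arcDiff-forward : ∀ {p r} → p ≤ suc n → r ≤ suc n → ArcDiff (r ⊖ p) → p < r ⊎ p ≡ r + n
  arcDiff-forward {p} {r} p≤1+n r≤1+n a with <-cmp p r
  ... | tri< p<r _ _ = inj₁ p<r
  ... | tri≈ _ refl _ = contradiction (subst ArcDiff (x⊖x≡0 (≤-<-trans p≤1+n 1+n<N)) a) ¬ArcDiff-0
  ... | tri> _ _ r<p = inj₂ (backward (subst ArcDiff (x<a⇒x⊖a≡x+P∸a r<p p≤N) a))
    where
    p≤N : p ≤ N n
    p≤N = ≤-trans p≤1+n (<⇒≤ 1+n<N)
    n≤d : n ≤ r + N n ∸ p
    n≤d = begin
      n              ≡⟨ m+n∸m≡n n n ⟨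
      N n ∸ suc n    ≤⟨ ∸-monoʳ-≤ (N n) p≤1+n ⟩
      N n ∸ p        ≤⟨ ∸-monoˡ-≤ p (m≤n+m (N n) r) ⟩
      r + N n ∸ p    ∎
      where open ≤-Reasoning
    backward : ArcDiff (r + N n ∸ p) → p ≡ r + n
    backward (inj₁ (_ , d≤n∸1)) = contradiction (≤n∸1⇒<n d≤n∸1) (≤⇒≯ n≤d)
    backward (inj₂ d≡1+n) = ∸-cancelˡ-≡ (≤-trans p≤N (m≤n+m (N n) r)) (+-monoʳ-≤ r (<⇒≤ n<N))
      (trans d≡1+n (trans (sym N∸n≡1+n) (sym ([m+n]∸[m+o]≡n∸o r (N n) n))))

  arcDiff-1+n∸ : ∀ {p} → p ≤ n → ArcDiff (suc n ∸ p) → p ≡ 0 ⊎ (2 ≤ p × p ≤ n)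
  arcDiff-1+n∸ {zero}        _   _                  = inj₁ refl
  arcDiff-1+n∸ {suc zero}    _   (inj₁ (_ , n≤n∸1)) = contradiction (≤n∸1⇒<n n≤n∸1) (<-irrefl refl)
  arcDiff-1+n∸ {suc zero}    _   (inj₂ n≡1+n)       = contradiction n≡1+n (<⇒≢ (n<1+n n))
  arcDiff-1+n∸ {suc (suc _)} p≤n _                  = inj₂ (s≤s (s≤s z≤n) , p≤n)

  arcDiff-into-1+n : ∀ {p} → p < N n → ArcDiff (suc n ⊖ p) → p ≡ 0 ⊎ (2 ≤ p × p ≤ n)
  arcDiff-into-1+n {p} p<N a with <-cmp p (suc n)
  ... | tri≈ _ refl _ = contradiction (subst ArcDiff (x⊖x≡0 p<N) a) ¬ArcDiff-0
  ... | tri< p<1+n _ _ = arcDiff-1+n∸ (≤-pred p<1+n) (subst ArcDiff (a≤x⇒x⊖a≡x∸a (<⇒≤ p<1+n) 1+n<N) a)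
  ... | tri> _ _ 1+n<p = contradiction (subst ArcDiff (x<a⇒x⊖a≡x+P∸a 1+n<p (<⇒≤ p<N)) a) ¬long
    where
    1+n<d : suc n < suc n + N n ∸ p
    1+n<d = subst (_< suc n + N n ∸ p) (m+n∸n≡m (suc n) (N n))
      (∸-monoʳ-< p<N (m≤n+m (N n) (suc n)))
    ¬long : ¬ ArcDiff (suc n + N n ∸ p)
    ¬long (inj₁ (_ , d≤n∸1)) = contradiction (<-trans (≤n∸1⇒<n d≤n∸1) (n<1+n n)) (<⇒≯ 1+n<d)
    ¬long (inj₂ d≡1+n) = <-irrefl (sym d≡1+n) 1+n<d

  arcDiff-1→r : ∀ {r} → 2 ≤ r → r < n → ArcDiff (r ⊖ 1)
  arcDiff-1→r {r} 2≤r r<n = subst ArcDiff (sym (a≤x⇒x⊖a≡x∸a (≤-trans (s≤s z≤n) 2≤r) (<-trans r<n n<N)))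
    (inj₁ (∸-monoˡ-≤ 1 2≤r , ∸-monoˡ-≤ 1 (<⇒≤ r<n)))

  arcDiff-r→1+n : ∀ {r} → 2 ≤ r → r < n → ArcDiff (suc n ⊖ r)
  arcDiff-r→1+n {r} 2≤r r<n = subst ArcDiff (sym (a≤x⇒x⊖a≡x∸a (≤-trans (<⇒≤ r<n) (n≤1+n n)) 1+n<N))
    (inj₁ (m<n⇒0<n∸m (<-trans r<n (n<1+n n)) , ∸-monoʳ-≤ (suc n) 2≤r))

  arcDiff-1+n→1 : ArcDiff (1 ⊖ suc n)
  arcDiff-1+n→1 = subst ArcDiff (sym (x<a⇒x⊖a≡x+P∸a (s≤s 1≤n) (<⇒≤ 1+n<N))) (inj₂ N∸n≡1+n)

module Walks (n : ℕ) where

  walk-start : ∀ {S : V n → Set} {x y} → Walk⁺ n S x y → S x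
  walk-start (arc sx _ _) = sx
  walk-start (sx ∷ _)     = sx

  walk-last-arc : ∀ {S : V n → Set} {x y} → Walk⁺ n S x y → ∃[ z ] (S z × Arc n z y)
  walk-last-arc (arc {x} sx _ a) = x , sx , a
  walk-last-arc (_ ∷ (_ , w))    = walk-last-arc w

  walk-mono : ∀ {S T : V n → Set} → (∀ {x} → S x → T x) → ∀ {x y} → Walk⁺ n S x y → Walk⁺ n T x y
  walk-mono S⊆T (arc sx sy a)  = arc (S⊆T sx) (S⊆T sy) a
  walk-mono S⊆T (sx ∷ (a , w)) = S⊆T sx ∷ (a , walk-mono S⊆T w)

  acyclic-mono : ∀ {S T : V n → Set} → (∀ {x} → S x → T x) → Acyclic n T → Acyclic n S
  acyclic-mono S⊆T acT x w = acT x (walk-mono S⊆T w)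

  module _ {S : V n → Set} (f : V n → ℕ)
           (increasing : ∀ {x y} → S x → S y → Arc n x y → f x < f y) where

    walk-increasing : ∀ {x y} → Walk⁺ n S x y → f x < f y
    walk-increasing (arc sx sy a)  = increasing sx sy a
    walk-increasing (sx ∷ (a , w)) = <-trans (increasing sx (walk-start w) a) (walk-increasing w)

    acyclic-potential : Acyclic n S
    acyclic-potential x w = <-irrefl refl (walk-increasing w)

  module _ {S T : V n → Set} (w : V n) (acS : Acyclic n S) (T⊆S+w : ∀ {x} → T x → S x ⊎ x ≡ w)
           (no-arc-into-w : ∀ {y} → T y → ¬ Arc n y w) where

    private
      in-S : ∀ {x} → T x → x ≢ w → S x
      in-S tx x≢w with T⊆S+w tx
      ... | inj₁ sx  = sx
      ... | inj₂ x≡w = contradiction x≡w x≢w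

      arc-target≢w : ∀ {x y} → T x → Arc n x y → y ≢ w
      arc-target≢w tx a refl = no-arc-into-w tx a

      avoiding-w : ∀ {x y} → Walk⁺ n T x y → x ≢ w → Walk⁺ n S x y
      avoiding-w (arc tx ty a)   x≢w = arc (in-S tx x≢w) (in-S ty (arc-target≢w tx a)) a
      avoiding-w (tx ∷ (a , wk)) x≢w = in-S tx x≢w ∷ (a , avoiding-w wk (arc-target≢w tx a))

    acyclic-extend : Acyclic n T
    acyclic-extend x wk with x ≟ᶠ w
    ... | no x≢w = acS x (avoiding-w wk x≢w)
    ... | yes refl = let (_ , tz , a) = walk-last-arc wk in no-arc-into-w tz a

  arc? : ∀ x y → Dec (Arc n x y)
  arc? x y = ((1 ≤? d) ×-dec (d ≤? n ∸ 1)) ⊎-dec (d ≟ suc n)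
    where d = diff n x y

  IsSource : (V n → Set) → V n → Set
  IsSource S s = S s × (∀ y → S y → ¬ Arc n y s)

  module _ {S : V n → Set} (S? : Decidable S) (acS : Acyclic n S) where

    private
      isSource? : Decidable (IsSource S)
      isSource? s = S? s ×-dec all? (λ y → S? y →-dec ¬? (arc? y s))

      predecessor : ¬ (∃[ s ] IsSource S s) → ∀ {s} → S s → ∃[ y ] (S y × Arc n y s)
      predecessor none {s} ss with any? (λ y → S? y ×-dec arc? y s)
      ... | yes found = found
      ... | no ¬found = contradiction (s , ss , λ y sy a → ¬found (y , sy , a)) none

      -- Without a source, predecessors can be followed back forever, and N n + 1 of them
      -- must repeat a vertex.
      module Chain (none : ¬ (∃[ s ] IsSource S s)) {x₀} (sx₀ : S x₀) where
        chain : ℕ → Σ (V n) S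
        chain zero    = x₀ , sx₀
        chain (suc i) = let (y , sy , _) = predecessor none (proj₂ (chain i)) in y , sy

        chain-arc : ∀ i → Arc n (proj₁ (chain (suc i))) (proj₁ (chain i))
        chain-arc i = proj₂ (proj₂ (predecessor none (proj₂ (chain i))))

        chain-walk : ∀ i d → Walk⁺ n S (proj₁ (chain (suc d + i))) (proj₁ (chain i))
        chain-walk i zero    = arc (proj₂ (chain (suc i))) (proj₂ (chain i)) (chain-arc i)
        chain-walk i (suc d) = proj₂ (chain (suc (suc d) + i)) ∷ (chain-arc (suc d + i) , chain-walk i d)

        chain-injective : ∀ {i j} → i < j → proj₁ (chain i) ≢ proj₁ (chain j)
        chain-injective {i} {j} i<j eq = acS (proj₁ (chain i))
          (subst (λ v → Walk⁺ n S v (proj₁ (chain i))) (trans (cong (λ m → proj₁ (chain m)) j≡) (sym eq))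
            (chain-walk i (j ∸ suc i)))
          where
          j≡ : suc (j ∸ suc i) + i ≡ j
          j≡ = trans (sym (+-suc (j ∸ suc i) i)) (m∸n+n≡m i<j)

        impossible : ⊥
        impossible =
          let (i , j , i<j , eq) = pigeonhole (n<1+n (N n)) (λ i → proj₁ (chain (toℕ i)))
          in chain-injective i<j eq

    source : ∀ {x₀} → S x₀ → ∃[ s ] IsSource S s
    source sx₀ with any? isSource?
    ... | yes found = found
    ... | no none   = ⊥-elim (Chain.impossible none sx₀)

module _ {A : Set} (_≟_ : DecidableEquality A) where

  private
    length≤1+length-without : ∀ y {xs} → Unique xs → length xs ≤ suc (length (filter (λ x → ¬? (x ≟ y)) xs))
    length≤1+length-without y {[]} _ = z≤n
    length≤1+length-without y {x ∷ xs} (x∉xs ∷ unique) with x ≟ y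
    ... | yes refl = s≤s (≤-reflexive (sym (cong length
                       (filter-all (λ x → ¬? (x ≟ y)) (All.map (λ x≢z z≡x → x≢z (sym z≡x)) x∉xs)))))
    ... | no _     = s≤s (length≤1+length-without y unique)

  unique-⊆⇒length≤ : ∀ {xs ys : List A} → Unique xs → (∀ {x} → x ∈ xs → x ∈ ys) → length xs ≤ length ys
  unique-⊆⇒length≤ {[]}     {_}      _      _     = z≤n
  unique-⊆⇒length≤ {x ∷ _}  {[]}     _      xs⊆[] with () ← xs⊆[] (here refl)
  unique-⊆⇒length≤ {xs}     {y ∷ ys} unique xs⊆ =
    ≤-trans (length≤1+length-without y unique)
            (s≤s (unique-⊆⇒length≤ (Unique.filter⁺ (λ x → ¬? (x ≟ y)) unique) without-y⊆ys))
    where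
    without-y⊆ys : ∀ {x} → x ∈ filter (λ x → ¬? (x ≟ y)) xs → x ∈ ys
    without-y⊆ys x∈ with ∈-filter⁻ (λ x → ¬? (x ≟ y)) {xs = xs} x∈
    ... | x∈xs , x≢y with xs⊆ x∈xs
    ... | here x≡y  = contradiction x≡y x≢y
    ... | there x∈ys = x∈ys

two-members⇒2≤length : ∀ {A : Set} {x y : A} {xs} → x ≢ y → x ∈ xs → y ∈ xs → 2 ≤ length xs
two-members⇒2≤length {xs = _ ∷ _ ∷ _}     _   _           _           = s≤s (s≤s z≤n)
two-members⇒2≤length {xs = _ ∷ []}        x≢y (here refl) (here refl) = contradiction refl x≢y

module Recolouring (n k : ℕ) where
  open Walks n

  recolour : (V n → Fin k) → V n → Fin k → V n → Fin k
  recolour f v c x with x ≟ᶠ v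
  ... | yes _ = c
  ... | no _  = f x

  recolour-at : ∀ f v c → recolour f v c v ≡ c
  recolour-at f v c with v ≟ᶠ v
  ... | yes _  = refl
  ... | no v≢v = contradiction refl v≢v

  recolour-elsewhere : ∀ f {v} c {x} → x ≢ v → recolour f v c x ≡ f x
  recolour-elsewhere f {v} c {x} x≢v with x ≟ᶠ v
  ... | yes x≡v = contradiction x≡v x≢v
  ... | no _    = refl

  recolour-keeps : ∀ f v c {x} → f x ≡ c → recolour f v c x ≡ c
  recolour-keeps f v c {x} fx≡c with x ≟ᶠ v
  ... | yes _ = refl
  ... | no _  = fx≡c

  recolour-class : ∀ f v c {x i} → recolour f v c x ≡ i → (x ≡ v × c ≡ i) ⊎ (x ≢ v × f x ≡ i)
  recolour-class f v c {x} eq with x ≟ᶠ v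
  ... | yes x≡v = inj₁ (x≡v , eq)
  ... | no x≢v  = inj₂ (x≢v , eq)

  CanRecolour : Coloring n k → V n → Fin k → Set
  CanRecolour β v c = Acyclic n (λ x → x ≡ v ⊎ col n k β x ≡ c)

  recolour-isColoring : ∀ β v c → CanRecolour β v c → IsColoring n k (recolour (col n k β) v c)
  recolour-isColoring (f , isColoring) v c acyclic i with i ≟ᶠ c
  ... | yes refl = acyclic-mono new-class acyclic
    where
    new-class : ∀ {x} → recolour f v c x ≡ c → x ≡ v ⊎ f x ≡ c
    new-class {x} eq with recolour-class f v c eq
    ... | inj₁ (x≡v , _) = inj₁ x≡v
    ... | inj₂ (_ , fx≡c) = inj₂ fx≡c
  ... | no i≢c = acyclic-mono old-class (isColoring i)
    where
    old-class : ∀ {x} → recolour f v c x ≡ i → f x ≡ i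
    old-class {x} eq with recolour-class f v c eq
    ... | inj₁ (_ , c≡i) = contradiction (sym c≡i) i≢c
    ... | inj₂ (_ , fx≡i) = fx≡i

  recolouring : ∀ β v c → CanRecolour β v c → Coloring n k
  recolouring β v c acyclic = recolour (col n k β) v c , recolour-isColoring β v c acyclic

  recolouring-adjacent : ∀ β v c (acyclic : CanRecolour β v c) → col n k β v ≢ c
                       → Adj n k β (recolouring β v c acyclic)
  recolouring-adjacent β v c _ βv≢c =
    v , (λ eq → βv≢c (trans eq (recolour-at (col n k β) v c))) ,
    λ w w≢v → sym (recolour-elsewhere (col n k β) c w≢v)

  path-append : ∀ {α β γ l m} → PathLen n k α β l → PathLen n k β γ m → PathLen n k α γ (l + m)
  path-append here         q = q
  path-append (step adj p) q = step adj (path-append p q)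

  module _ (j : Fin k) where

    count : List (V n) → (V n → Fin k) → ℕ
    count L f = length (filter (λ x → f x ≟ᶠ j) L)

    count-accept : ∀ {f x} L → f x ≡ j → count (x ∷ L) f ≡ suc (count L f)
    count-accept {f} L fx≡j = cong length (filter-accept (λ y → f y ≟ᶠ j) {xs = L} fx≡j)

    count-reject : ∀ {f x} L → f x ≢ j → count (x ∷ L) f ≡ count L f
    count-reject {f} L fx≢j = cong length (filter-reject (λ y → f y ≟ᶠ j) {xs = L} fx≢j)

    count-mono : ∀ {f g} L → (∀ {y} → f y ≡ j → g y ≡ j) → count L f ≤ count L g
    count-mono [] _ = z≤n
    count-mono {f} {g} (y ∷ L) f⊆g with f y ≟ᶠ j | g y ≟ᶠ j
    ... | yes _   | yes _   = s≤s (count-mono L f⊆g)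
    ... | yes fy  | no ¬gy  = contradiction (f⊆g fy) ¬gy
    ... | no _    | yes _   = m≤n⇒m≤1+n (count-mono L f⊆g)
    ... | no _    | no _    = count-mono L f⊆g

    classSize≤count : ∀ {f} L → (∀ {x} → f x ≡ j → x ∈ L) → classSize n k f j ≤ count L f
    classSize≤count {f} L class⊆L =
      unique-⊆⇒length≤ _≟ᶠ_ (Unique.filter⁺ (λ x → f x ≟ᶠ j) (Unique.allFin⁺ (N n))) class⊆
      where
      class⊆ : ∀ {x} → x ∈ filter (λ x → f x ≟ᶠ j) (allFin (N n)) → x ∈ filter (λ x → f x ≟ᶠ j) L
      class⊆ x∈ = let (_ , fx≡j) = ∈-filter⁻ (λ x → f x ≟ᶠ j) {xs = allFin (N n)} x∈
                  in ∈-filter⁺ (λ x → f x ≟ᶠ j) (class⊆L fx≡j) fx≡j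

    2≤classSize : ∀ {f x y} → x ≢ y → f x ≡ j → f y ≡ j → 2 ≤ classSize n k f j
    2≤classSize {f} {x} {y} x≢y fx≡j fy≡j = two-members⇒2≤length x≢y
      (∈-filter⁺ (λ x → f x ≟ᶠ j) (∈-allFin x) fx≡j) (∈-filter⁺ (λ x → f x ≟ᶠ j) (∈-allFin y) fy≡j)

    module _ {T : V n → Set} (acT : Acyclic n T) where

      record Filled (β : Coloring n k) (L : List (V n)) : Set where
        field
          result      : Coloring n k
          steps       : ℕ
          path        : PathLen n k β result steps
          steps-bound : steps + count L (col n k β) ≤ length L
          class⊆T     : ∀ {x} → col n k result x ≡ j → T x
          covers      : ∀ {x} → x ∈ L → col n k result x ≡ j
          class-grows : ∀ {x} → col n k β x ≡ j → col n k result x ≡ j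

      fill : ∀ β → (∀ {x} → col n k β x ≡ j → T x) → ∀ L → (∀ {x} → x ∈ L → T x) → Filled β L
      fill β β⊆T [] _ = record
        { result = β ; steps = 0 ; path = here ; steps-bound = z≤n
        ; class⊆T = β⊆T ; covers = λ () ; class-grows = λ eq → eq }
      fill β β⊆T (x ∷ L) L⊆T with col n k β x ≟ᶠ j
      ... | yes βx≡j = record
        { result = result ; steps = steps ; path = path ; steps-bound = bound ; class⊆T = class⊆T
        ; covers = λ { (here refl) → class-grows βx≡j ; (there y∈L) → covers y∈L } ; class-grows = class-grows }
        where
        rest : Filled β L
        rest = fill β β⊆T L (λ y∈L → L⊆T (there y∈L))
        open Filled rest
        bound : steps + count (x ∷ L) (col n k β) ≤ suc (length L)
        bound = begin
          steps + count (x ∷ L) (col n k β)  ≡⟨ cong (steps +_) (count-accept L βx≡j) ⟩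
          steps + suc (count L (col n k β))  ≡⟨ +-suc steps _ ⟩
          suc (steps + count L (col n k β))  ≤⟨ s≤s steps-bound ⟩
          suc (length L)                     ∎
          where open ≤-Reasoning
      ... | no βx≢j = record
        { result = result ; steps = suc steps ; path = step (recolouring-adjacent β x j can βx≢j) path
        ; steps-bound = bound ; class⊆T = class⊆T
        ; covers = λ { (here refl) → class-grows (recolour-at (col n k β) x j) ; (there y∈L) → covers y∈L }
        ; class-grows = class-grows ∘ β⊆β₁ }
        where
        Tx : T x
        Tx = L⊆T (here refl)
        can : CanRecolour β x j
        can = acyclic-mono (λ { (inj₁ refl) → Tx ; (inj₂ βy≡j) → β⊆T βy≡j }) acT
        β₁ : Coloring n k
        β₁ = recolouring β x j can
        β₁⊆T : ∀ {y} → col n k β₁ y ≡ j → T y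
        β₁⊆T {y} eq with recolour-class (col n k β) x j {y} eq
        ... | inj₁ (refl , _) = Tx
        ... | inj₂ (_ , βy≡j) = β⊆T βy≡j
        open Filled (fill β₁ β₁⊆T L (λ y∈L → L⊆T (there y∈L)))
        β⊆β₁ : ∀ {y} → col n k β y ≡ j → col n k β₁ y ≡ j
        β⊆β₁ = recolour-keeps (col n k β) x j
        bound : suc steps + count (x ∷ L) (col n k β) ≤ suc (length L)
        bound = begin
          suc steps + count (x ∷ L) (col n k β)  ≡⟨ cong (suc steps +_) (count-reject L βx≢j) ⟩
          suc (steps + count L (col n k β))      ≤⟨ s≤s (+-monoʳ-≤ steps (count-mono L β⊆β₁)) ⟩
          suc (steps + count L (col n k β₁))     ≤⟨ s≤s steps-bound ⟩
          suc (length L)                         ∎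
          where open ≤-Reasoning

module Regions (n : ℕ) (2≤n : 2 ≤ n) where
  1≤n : 1 ≤ n
  1≤n = ≤-trans (s≤s z≤n) 2≤n

  open Tournament n 1≤n public
  open Walks n public

  Region : V n → (ℕ → Set) → V n → Set
  Region a Q x = Q (diff n a x)

  acyclic-region : ∀ {Q} → (∀ {p} → Q p → p ≤ suc n) → (∀ {p r} → Q p → Q r → p ≢ r + n)
                 → ∀ a → Acyclic n (Region a Q)
  acyclic-region {Q} bounded no-back-arc a = acyclic-potential (diff n a) increasing
    where
    increasing : ∀ {x y} → Region a Q x → Region a Q y → Arc n x y → diff n a x < diff n a y
    increasing qx qy xy with arcDiff-forward (bounded qx) (bounded qy) (arc-relative a xy)
    ... | inj₁ lt = lt
    ... | inj₂ eq = contradiction eq (no-back-arc qx qy)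

  record Enumeration (Q : ℕ → Set) : Set where
    field
      offsets  : List ℕ
      length≡n : length offsets ≡ n
      sound    : ∀ {p} → p ∈ offsets → Q p
      complete : ∀ {p} → Q p → p ∈ offsets
      bounded  : ∀ {p} → Q p → p < N n

    vertices : V n → List (V n)
    vertices a = map (add n a) offsets

    vertices-sound : ∀ a {x} → x ∈ vertices a → Region a Q x
    vertices-sound a x∈ with ∈-map⁻ (add n a) x∈
    ... | p , p∈ , refl = subst Q (sym (diff-add a (bounded (sound p∈)))) (sound p∈)

    vertices-complete : ∀ a {x} → Region a Q x → x ∈ vertices a
    vertices-complete a {x} qx = subst (_∈ vertices a) (add-diff a x) (∈-map⁺ (add n a) (complete qx))

    length-vertices : ∀ a → length (vertices a) ≡ n
    length-vertices a = trans (length-map (add n a) offsets) length≡n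

  InInterval : ℕ → Set
  InInterval p = p < n

  InBent : ℕ → Set
  InBent p = p ≡ 0 ⊎ (2 ≤ p × p < n) ⊎ p ≡ suc n

  ¬InBent-1 : ¬ InBent 1
  ¬InBent-1 (inj₁ ())
  ¬InBent-1 (inj₂ (inj₁ (s≤s () , _)))
  ¬InBent-1 (inj₂ (inj₂ 1≡1+n)) = contradiction (suc-injective 1≡1+n) (<⇒≢ 1≤n)

  interval-cases : ∀ {p} → p < n → p ≡ 0 ⊎ p ≡ 1 ⊎ (2 ≤ p × p < n)
  interval-cases {zero}        _   = inj₁ refl
  interval-cases {suc zero}    _   = inj₂ (inj₁ refl)
  interval-cases {suc (suc _)} p<n = inj₂ (inj₂ (s≤s (s≤s z≤n) , p<n))

  InPunctured : ℕ → Set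
  InPunctured p = p < n × p ≢ 1

  punctured⇒bent : ∀ {p} → InPunctured p → InBent p
  punctured⇒bent {zero}        _         = inj₁ refl
  punctured⇒bent {suc zero}    (_ , 1≢1) = contradiction refl 1≢1
  punctured⇒bent {suc (suc _)} (p<n , _) = inj₂ (inj₁ (s≤s (s≤s z≤n) , p<n))

  bent⇒punctured : ∀ {p} → InBent p → p ≢ suc n → InPunctured p
  bent⇒punctured (inj₁ refl)               _     = 1≤n , λ ()
  bent⇒punctured (inj₂ (inj₁ (2≤p , p<n))) _     = p<n , λ p≡1 → <⇒≱ (subst (_< 2) (sym p≡1) ≤-refl) 2≤p
  bent⇒punctured (inj₂ (inj₂ p≡1+n))       p≢1+n = contradiction p≡1+n p≢1+n

  interval : Enumeration InInterval
  interval = record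
    { offsets = upTo n ; length≡n = length-upTo n ; sound = ∈-upTo⁻ ; complete = ∈-upTo⁺
    ; bounded = λ p<n → <-trans p<n n<N }

  bent : Enumeration InBent
  bent = record
    { offsets = 0 ∷ suc n ∷ middle ; length≡n = length≡n
    ; sound = sound ; complete = complete ; bounded = bounded }
    where
    middle : List ℕ
    middle = map (2 +_) (upTo (n ∸ 2))
    length≡n : 2 + length middle ≡ n
    length≡n = trans (cong (2 +_) (trans (length-map (2 +_) (upTo (n ∸ 2))) (length-upTo (n ∸ 2))))
                     (m+[n∸m]≡n 2≤n)
    sound : ∀ {p} → p ∈ 0 ∷ suc n ∷ middle → InBent p
    sound (here refl)         = inj₁ refl
    sound (there (here refl)) = inj₂ (inj₂ refl)
    sound (there (there p∈)) with ∈-map⁻ (2 +_) p∈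
    ... | i , i∈ , refl =
      inj₂ (inj₁ (s≤s (s≤s z≤n) , subst (2 + i <_) (m+[n∸m]≡n 2≤n) (+-monoʳ-< 2 (∈-upTo⁻ i∈))))
    complete : ∀ {p} → InBent p → p ∈ 0 ∷ suc n ∷ middle
    complete (inj₁ refl)               = here refl
    complete (inj₂ (inj₂ refl))        = there (here refl)
    complete (inj₂ (inj₁ (2≤p , p<n))) = there (there (subst (_∈ middle) (m+[n∸m]≡n 2≤p)
                                           (∈-map⁺ (2 +_) (∈-upTo⁺ (∸-monoˡ-< p<n 2≤p)))))
    bounded : ∀ {p} → InBent p → p < N n
    bounded (inj₁ refl)             = ≤-<-trans z≤n n<N
    bounded (inj₂ (inj₁ (_ , p<n))) = <-trans p<n n<N
    bounded (inj₂ (inj₂ refl))      = 1+n<N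

  acyclic-interval : ∀ a → Acyclic n (Region a InInterval)
  acyclic-interval = acyclic-region (λ p<n → ≤-trans (<⇒≤ p<n) (n≤1+n n))
    (λ {p} {r} p<n _ p≡r+n → <⇒≱ p<n (subst (n ≤_) (sym p≡r+n) (m≤n+m n r)))

  acyclic-bent : ∀ a → Acyclic n (Region a InBent)
  acyclic-bent = acyclic-region bent≤1+n no-back-arc
    where
    bent≤1+n : ∀ {p} → InBent p → p ≤ suc n
    bent≤1+n (inj₁ refl)             = z≤n
    bent≤1+n (inj₂ (inj₁ (_ , p<n))) = ≤-trans (<⇒≤ p<n) (n≤1+n n)
    bent≤1+n (inj₂ (inj₂ refl))      = ≤-refl
    no-back-arc : ∀ {p r} → InBent p → InBent r → p ≢ r + n
    no-back-arc {r = r} (inj₁ refl) _ = <⇒≢ (≤-trans (s≤s z≤n) (≤-trans 2≤n (m≤n+m n r)))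
    no-back-arc {r = r} (inj₂ (inj₁ (_ , p<n))) _ p≡r+n = <⇒≱ p<n (subst (n ≤_) (sym p≡r+n) (m≤n+m n r))
    no-back-arc {r = zero}        (inj₂ (inj₂ refl)) _  1+n≡n   = <-irrefl (sym 1+n≡n) (n<1+n n)
    no-back-arc {r = suc zero}    (inj₂ (inj₂ refl)) q1 _       = ¬InBent-1 q1
    no-back-arc {r = suc (suc r)} (inj₂ (inj₂ refl)) _  1+n≡r+n =
      <-irrefl (suc-injective 1+n≡r+n) (s≤s (m≤n+m n r))

third-colour : ∀ {k} → 3 ≤ k → (i i′ : Fin k) → ∃[ c ] (c ≢ i × c ≢ i′)
third-colour (s≤s (s≤s (s≤s _))) F.zero            F.zero            = F.suc F.zero , (λ ()) , (λ ())
third-colour (s≤s (s≤s (s≤s _))) F.zero            (F.suc F.zero)    = F.suc (F.suc F.zero) , (λ ()) , (λ ())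
third-colour (s≤s (s≤s (s≤s _))) F.zero            (F.suc (F.suc _)) = F.suc F.zero , (λ ()) , (λ ())
third-colour (s≤s (s≤s (s≤s _))) (F.suc F.zero)    F.zero            = F.suc (F.suc F.zero) , (λ ()) , (λ ())
third-colour (s≤s (s≤s (s≤s _))) (F.suc F.zero)    (F.suc _)         = F.zero , (λ ()) , (λ ())
third-colour (s≤s (s≤s (s≤s _))) (F.suc (F.suc _)) F.zero            = F.suc F.zero , (λ ()) , (λ ())
third-colour (s≤s (s≤s (s≤s _))) (F.suc (F.suc _)) (F.suc _)         = F.zero , (λ ()) , (λ ())

module Moves (n k : ℕ) (2≤n : 2 ≤ n) (j : Fin k) where
  open Regions n 2≤n
  open Recolouring n k

  _HasClass_ : Coloring n k → (V n → Set) → Set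
  β HasClass R = ∀ x → (col n k β x ≡ j → R x) × (R x → col n k β x ≡ j)

  fill-region : ∀ {Q} (E : Enumeration Q) a → Acyclic n (Region a Q) → (α : Coloring n k)
              → (∀ {x} → col n k α x ≡ j → Region a Q x)
              → ∃[ β ] ∃[ m ] (PathLen n k α β m × m + classSize n k (col n k α) j ≤ n × β HasClass Region a Q)
  fill-region {Q} E a acyclic α α⊆Q =
    result , steps , path , within , λ x → class⊆T , λ qx → covers (vertices-complete a qx)
    where
    open Enumeration E
    open Filled (fill j acyclic α α⊆Q (vertices a) (vertices-sound a))
    α⊆vertices : ∀ {x} → col n k α x ≡ j → x ∈ vertices a
    α⊆vertices = vertices-complete a ∘ α⊆Q
    within : steps + classSize n k (col n k α) j ≤ n
    within = begin
      steps + classSize n k (col n k α) j       ≤⟨ +-monoʳ-≤ steps (classSize≤count j (vertices a) α⊆vertices) ⟩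
      steps + count j (vertices a) (col n k α)  ≤⟨ steps-bound ⟩
      length (vertices a)                       ≡⟨ length-vertices a ⟩
      n                                         ∎
      where open ≤-Reasoning

  isInterval : ∀ β a → β HasClass Region a InInterval → IsInterval n k (col n k β) j a
  isInterval β a class x =
    (λ eq → diff n a x , proj₁ (class x) eq , sym (add-diff a x)) ,
    λ { (t , t<n , refl) → proj₂ (class _) (subst (_< n) (sym (diff-add a (<-trans t<n n<N))) t<n) }

  -- The in-neighbours of a + n + 1 are a, a + 2, …, a + n, all coloured j except a + n.
  bent-to-punctured : 3 ≤ k → ∀ a β → β HasClass Region a InBent
                    → ∃[ γ ] (Adj n k β γ × γ HasClass Region a InPunctured)
  bent-to-punctured 3≤k a β class≡bent = γ , recolouring-adjacent β z c can c≢fz , class≡punctured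
    where
    f : V n → Fin k
    f = col n k β
    v z : V n
    v = add n a n
    z = add n a (suc n)
    diff-v : diff n a v ≡ n
    diff-v = diff-add a n<N
    diff-z : diff n a z ≡ suc n
    diff-z = diff-add a 1+n<N
    c : Fin k
    c = proj₁ (third-colour 3≤k j (f v))
    c≢j : c ≢ j
    c≢j = proj₁ (proj₂ (third-colour 3≤k j (f v)))
    c≢fv : c ≢ f v
    c≢fv = proj₂ (proj₂ (third-colour 3≤k j (f v)))
    c≢fz : f z ≢ c
    c≢fz fz≡c = c≢j (trans (sym fz≡c) (proj₂ (class≡bent z) (subst InBent (sym diff-z) (inj₂ (inj₂ refl)))))

    no-arc-into-z : ∀ {y} → y ≡ z ⊎ f y ≡ c → ¬ Arc n y z
    no-arc-into-z (inj₁ refl) yz = arc-irreflexive z yz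
    no-arc-into-z {y} (inj₂ fy≡c) yz
      with arcDiff-into-1+n (diff-< a y) (subst (λ d → ArcDiff (d ⊖ diff n a y)) diff-z (arc-relative a yz))
    ... | inj₁ p≡0 = c≢j (trans (sym fy≡c) (proj₂ (class≡bent y) (inj₁ p≡0)))
    ... | inj₂ (2≤p , p≤n) with m≤n⇒m<n∨m≡n p≤n
    ...   | inj₁ p<n = c≢j (trans (sym fy≡c) (proj₂ (class≡bent y) (inj₂ (inj₁ (2≤p , p<n)))))
    ...   | inj₂ p≡n = c≢fv (trans (sym fy≡c) (cong f (diff-injective a (trans p≡n (sym diff-v)))))

    can : CanRecolour β z c
    can = acyclic-extend z (proj₂ β c) (λ { (inj₁ y≡z) → inj₂ y≡z ; (inj₂ fy≡c) → inj₁ fy≡c }) no-arc-into-z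
    γ : Coloring n k
    γ = recolouring β z c can

    class≡punctured : γ HasClass Region a InPunctured
    class≡punctured x = to , from
      where
      to : col n k γ x ≡ j → InPunctured (diff n a x)
      to eq with recolour-class f z c {x} eq
      ... | inj₁ (_ , c≡j)    = contradiction c≡j c≢j
      ... | inj₂ (x≢z , fx≡j) =
        bent⇒punctured (proj₁ (class≡bent x) fx≡j) (λ p≡1+n → x≢z (diff-injective a (trans p≡1+n (sym diff-z))))
      from : InPunctured (diff n a x) → col n k γ x ≡ j
      from q = trans (recolour-elsewhere f c x≢z) (proj₂ (class≡bent x) (punctured⇒bent q))
        where
        x≢z : x ≢ z
        x≢z refl = <⇒≯ (n<1+n n) (subst (_< n) diff-z (proj₁ q))

  punctured-to-interval : ∀ a β → β HasClass Region a InPunctured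
                        → ∃[ γ ] (Adj n k β γ × γ HasClass Region a InInterval)
  punctured-to-interval a β class≡punctured = γ , recolouring-adjacent β u j can fu≢j , class≡interval
    where
    f : V n → Fin k
    f = col n k β
    u : V n
    u = add n a 1
    diff-u : diff n a u ≡ 1
    diff-u = diff-add a (≤-<-trans 1≤n n<N)
    u-in-interval : diff n a u < n
    u-in-interval = subst (_< n) (sym diff-u) 2≤n
    fu≢j : f u ≢ j
    fu≢j fu≡j = proj₂ (proj₁ (class≡punctured u) fu≡j) diff-u
    can : CanRecolour β u j
    can = acyclic-mono (λ { (inj₁ refl) → u-in-interval ; (inj₂ fy≡j) → proj₁ (proj₁ (class≡punctured _) fy≡j) })
                       (acyclic-interval a)
    γ : Coloring n k
    γ = recolouring β u j can

    class≡interval : γ HasClass Region a InInterval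
    class≡interval x = to , from
      where
      to : col n k γ x ≡ j → diff n a x < n
      to eq with recolour-class f u j {x} eq
      ... | inj₁ (x≡u , _) = subst (λ y → diff n a y < n) (sym x≡u) u-in-interval
      ... | inj₂ (_ , fx≡j) = proj₁ (proj₁ (class≡punctured x) fx≡j)
      from : diff n a x < n → col n k γ x ≡ j
      from p<n with diff n a x ≟ 1
      ... | yes p≡1 = subst (λ y → col n k γ y ≡ j) (diff-injective a (trans diff-u (sym p≡1)))
                            (recolour-at f u j)
      ... | no p≢1  = trans (recolour-elsewhere f j (λ x≡u → p≢1 (trans (cong (diff n a) x≡u) diff-u)))
                            (proj₂ (class≡punctured x) (p<n , p≢1))

  bent-to-interval : 3 ≤ k → ∀ a β → β HasClass Region a InBent
                   → ∃[ γ ] (PathLen n k β γ 2 × γ HasClass Region a InInterval)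
  bent-to-interval 3≤k a β class≡bent =
    let (β₁ , adj₁ , class₁) = bent-to-punctured 3≤k a β class≡bent
        (β₂ , adj₂ , class₂) = punctured-to-interval a β₁ class₁
    in β₂ , step {γ = β₁} adj₁ (step {γ = β₂} adj₂ here) , class₂

module ClassShape (n k : ℕ) (2≤n : 2 ≤ n) (α : Coloring n k) (j : Fin k) where
  open Regions n 2≤n
  open Recolouring n k using (2≤classSize)

  private
    f : V n → Fin k
    f = col n k α
    C : V n → Set
    C x = f x ≡ j

  source-offsets : ∀ {s} → IsSource C s → ∀ {y} → C y → diff n s y < n ⊎ diff n s y ≡ suc n
  source-offsets {s} (_ , no-arc-into-s) {y} cy with y ≟ᶠ s
  ... | yes refl = inj₁ (subst (_< n) (sym (diff-self s)) 1≤n)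
  ... | no y≢s with tournament y≢s
  ...   | inj₁ ys = contradiction ys (no-arc-into-s y cy)
  ...   | inj₂ sy = arcDiff-range sy

  module _ {s u z} (cu : C u) (cz : C z) (diff-u : diff n s u ≡ 1) (diff-z : diff n s z ≡ suc n) where

    no-middle : ∀ {r} → C r → ¬ (2 ≤ diff n s r × diff n s r < n)
    no-middle {r} cr (2≤p , p<n) = proj₂ α j u
      (cu ∷ (u→r , (cr ∷ (r→z , arc cz cu z→u))))
      where
      u→r : Arc n u r
      u→r = arc-relative⁻ s (subst (λ d → ArcDiff (diff n s r ⊖ d)) (sym diff-u) (arcDiff-1→r 2≤p p<n))
      r→z : Arc n r z
      r→z = arc-relative⁻ s (subst (λ d → ArcDiff (d ⊖ diff n s r)) (sym diff-z) (arcDiff-r→1+n 2≤p p<n))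
      z→u : Arc n z u
      z→u = arc-relative⁻ s (subst₂ (λ d e → ArcDiff (d ⊖ e)) (sym diff-u) (sym diff-z) arcDiff-1+n→1)

    forbidden-triangle : IsSource C s → IsForbiddenTriangle n k f j
    forbidden-triangle source = z , λ x → members , λ
      { (inj₁ refl)        → cz
      ; (inj₂ (inj₁ refl)) → subst C (sym z+n≡s) (proj₁ source)
      ; (inj₂ (inj₂ refl)) → subst C (sym z+n+1≡u) cu }
      where
      z+n≡s : add n z n ≡ s
      z+n≡s = diff-injective s (begin
        diff n s (add n z n)   ≡⟨ diff-add-shift s z n ⟩
        (diff n s z + n) % N n ≡⟨ cong (λ d → (d + n) % N n) diff-z ⟩
        N n % N n              ≡⟨ n%n≡0 (N n) ⟩
        0                      ≡⟨ diff-self s ⟨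
        diff n s s             ∎)
        where open ≡-Reasoning
      z+n+1≡u : add n z (suc n) ≡ u
      z+n+1≡u = diff-injective s (begin
        diff n s (add n z (suc n))   ≡⟨ diff-add-shift s z (suc n) ⟩
        (diff n s z + suc n) % N n   ≡⟨ cong (λ d → (d + suc n) % N n) diff-z ⟩
        (suc n + suc n) % N n        ≡⟨ cong (λ m → suc m % N n) (+-suc n n) ⟩
        (1 + N n) % N n              ≡⟨ [m+n]%n≡m%n 1 (N n) ⟩
        1 % N n                      ≡⟨ m<n⇒m%n≡m (≤-<-trans 1≤n n<N) ⟩
        1                            ≡⟨ diff-u ⟨
        diff n s u                   ∎)
        where open ≡-Reasoning
      members : ∀ {x} → C x → x ≡ z ⊎ x ≡ add n z n ⊎ x ≡ add n z (suc n)
      members {x} cx with source-offsets source cx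
      ... | inj₂ p≡1+n = inj₁ (diff-injective s (trans p≡1+n (sym diff-z)))
      ... | inj₁ p<n with interval-cases p<n
      ...   | inj₁ p≡0          = inj₂ (inj₁ (trans (diff-injective s (trans p≡0 (sym (diff-self s)))) (sym z+n≡s)))
      ...   | inj₂ (inj₁ p≡1)   = inj₂ (inj₂ (trans (diff-injective s (trans p≡1 (sym diff-u))) (sym z+n+1≡u)))
      ...   | inj₂ (inj₂ middle) = contradiction middle (no-middle cx)

  data Shape : Set where
    interval-shaped : ∀ a → (∀ {x} → C x → Region a InInterval x) → Shape
    bent-shaped     : ∀ a → (∀ {x} → C x → Region a InBent x) → 2 ≤ classSize n k f j → Shape

  shape-from-source : ∀ {s} → IsSource C s → ¬ IsForbiddenTriangle n k f j → Shape
  shape-from-source {s} source ¬triangle with any? (λ z → (f z ≟ᶠ j) ×-dec (diff n s z ≟ suc n))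
  ... | no no-z = interval-shaped s in-interval
    where
    in-interval : ∀ {x} → C x → diff n s x < n
    in-interval {x} cx with source-offsets source cx
    ... | inj₁ p<n   = p<n
    ... | inj₂ p≡1+n = contradiction (x , cx , p≡1+n) no-z
  ... | yes (z , cz , diff-z) with any? (λ u → (f u ≟ᶠ j) ×-dec (diff n s u ≟ 1))
  ...   | yes (u , cu , diff-u) =
    contradiction (forbidden-triangle cu cz diff-u diff-z source) ¬triangle
  ...   | no no-u = bent-shaped s in-bent (2≤classSize j s≢z (proj₁ source) cz)
    where
    s≢z : s ≢ z
    s≢z s≡z = 0≢1+n (trans (sym (diff-self s)) (trans (cong (diff n s) s≡z) diff-z))
    in-bent : ∀ {x} → C x → InBent (diff n s x)
    in-bent {x} cx with source-offsets source cx
    ... | inj₂ p≡1+n = inj₂ (inj₂ p≡1+n)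
    ... | inj₁ p<n with interval-cases p<n
    ...   | inj₁ p≡0        = inj₁ p≡0
    ...   | inj₂ (inj₁ p≡1) = contradiction (x , cx , p≡1) no-u
    ...   | inj₂ (inj₂ mid) = inj₂ (inj₁ mid)

  shape : ¬ IsForbiddenTriangle n k f j → Shape
  shape ¬triangle with any? (λ x → f x ≟ᶠ j)
  ... | no empty     = interval-shaped F.zero (λ {x} cx → contradiction (x , cx) empty)
  ... | yes (_ , cx) = shape-from-source (proj₂ (source (λ x → f x ≟ᶠ j) (proj₂ α j) cx)) ¬triangle

module Reach (n k : ℕ) (2≤n : 2 ≤ n) (3≤k : 3 ≤ k) (α : Coloring n k) (j : Fin k) where
  open ClassShape n k 2≤n α j
  open Moves n k 2≤n j
  open Regions n 2≤n using (interval; bent; acyclic-interval; acyclic-bent)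
  open Recolouring n k using (path-append)

  |C| : ℕ
  |C| = classSize n k (col n k α) j

  Reaches : ℕ → Set
  Reaches budget =
    ∃[ a ] ∃[ β ] (IsInterval n k (col n k β) j a × ∃[ m ] (DistLe n k α β m × m + |C| ≤ budget))

  reach : ¬ IsForbiddenTriangle n k (col n k α) j → Reaches n ⊎ (Reaches (2 + n) × 2 ≤ |C|)
  reach ¬triangle with shape ¬triangle
  ... | interval-shaped a α⊆interval =
    let (β , m , path , within , class) = fill-region interval a (acyclic-interval a) α α⊆interval
    in inj₁ (a , β , isInterval β a class , m , (m , path , ≤-refl) , within)
  ... | bent-shaped a α⊆bent 2≤|C| =
    let (β , m , path , within , class) = fill-region bent a (acyclic-bent a) α α⊆bent
        (γ , path₂ , class₂) = bent-to-interval 3≤k a β class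
    in inj₂ ((a , γ , isInterval γ a class₂ , m + 2 , (m + 2 , path-append path path₂ , ≤-refl) ,
              subst (_≤ 2 + n) (trans (+-assoc 2 m |C|) (cong (_+ |C|) (+-comm 2 m))) (+-monoʳ-≤ 2 within)) ,
             2≤|C|)

lemma5 : (n k : ℕ) → 4 ≤ n → 3 ≤ k → (α : Coloring n k) → (j : Fin k)
    → ¬ IsForbiddenTriangle n k (col n k α) j
    → ∃[ a ] ∃[ β ] (IsInterval n k (col n k β) j a
        × (((classSize n k (col n k α) j ≡ 0 ⊎ classSize n k (col n k α) j ≡ 1)
              → ∃[ m ] (DistLe n k α β m × m + classSize n k (col n k α) j ≤ n))
          × (¬ (classSize n k (col n k α) j ≡ 0 ⊎ classSize n k (col n k α) j ≡ 1)
              → ∃[ m ] (DistLe n k α β m × m + classSize n k (col n k α) j ≤ suc (suc n)))))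
lemma5 n k 4≤n 3≤k α j ¬triangle with Reach.reach n k (≤-trans (s≤s (s≤s z≤n)) 4≤n) 3≤k α j ¬triangle
... | inj₁ (a , β , interval , m , d , within) =
  a , β , interval , (λ _ → m , d , within) , (λ _ → m , d , ≤-trans within (m≤n+m n 2))
... | inj₂ ((a , β , interval , m , d , within) , 2≤|C|) =
  a , β , interval , (λ { (inj₁ |C|≡0) → contradiction |C|≡0 (>⇒≢ (<-trans (s≤s z≤n) 2≤|C|))
                        ; (inj₂ |C|≡1) → contradiction |C|≡1 (>⇒≢ 2≤|C|) }) ,
  (λ _ → m , d , within)
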